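{- Let $D$ be a square-free integer other than $1$, let $K=\mathbb{Q}(\sqrt D)$ with ring of integers $\mathcal{O}_K$, and let $\delta=2$ if $D\equiv 1 \pmod 4$ and $\delta=1$ otherwise. Suppose $q$ is an odd prime such that $q\nmid D$ and $D\equiv n^2 \pmod q$ for some integer $n$. Then $n^2-D=lq$ for some $l\in\mathbb{Z}$, and, writing $\mathcal P=(q,n+\sqrt D)$ for the ideal of $\mathcal{O}_K$ generated by $q$ and $n+\sqrt D$ and $f(x,y)=lx^2+2nxy+qy^2$: (i) if $D<0$, then $\mathcal P$ is a principal ideal if and only if there exist integers $x,y$ with $f(x,y)=\delta^2$; (ii) if $D>0$, then $\mathcal P$ is a principal ideal if and only if there exist integers $x,y$ with $f(x,y)=\delta^2$ or $f(x,y)=-\delta^2$.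
   Context: A binary quadratic form $f$ with integer coefficients represents an integer $m$ if $f(x,y)=m$ for some integers $x,y$. The ideal $(q,n+\sqrt D)$ is a prime ideal of $\mathcal{O}_K$ lying over $q$. -}

module Defs where

open import Data.Nat as ℕ using (ℕ)
open import Data.Nat.Primality using (Prime)
open import Data.Integer using (ℤ; +_; _+_; _-_; _*_; -_; ∣_∣; _<_)
open import Data.Integer.Divisibility using (_∣_)
open import Data.Integer.DivMod using (_%ℕ_; _/ℕ_)
open import Data.Product using (Σ; ∃; _×_; _,_)
open import Relation.Nullary using (¬_; yes; no)
open import Relation.Binary.PropositionalEquality using (_≡_)
open import Function.Bundles using (_⇔_)

-- D is square-free: the only integers whose square divides D are ±1.
-- (In particular D = 0 is excluded.)
SquareFree : ℤ → Set
SquareFree D = ∀ (m : ℤ) → (m * m) ∣ D → ∣ m ∣ ≡ 1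

δ : ℤ → ℤ
δ D with D %ℕ 4 ℕ.≟ 1
... | yes _ = + 2
... | no  _ = + 1

-- Ring of integers O_K of K = ℚ(√D), D square-free, D ≠ 1, modelled as ℤ[ω]
-- with the standard integral basis {1, ω}:
--   ω = √D          if D ≢ 1 (mod 4),  ω² = D
--   ω = (1 + √D)/2  if D ≡ 1 (mod 4),  ω² = ω + (D - 1)/4
-- so ω² = ωt·ω + ωm.  The pair (a , b) stands for a + b·ω.
ωt : ℤ → ℤ
ωt D with D %ℕ 4 ℕ.≟ 1
... | yes _ = + 1
... | no  _ = + 0

ωm : ℤ → ℤ
ωm D with D %ℕ 4 ℕ.≟ 1
... | yes _ = (D - + 1) /ℕ 4
... | no  _ = D

O : Set
O = ℤ × ℤ

ι : ℤ → O
ι a = (a , + 0)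

_⊕_ : O → O → O
(a , b) ⊕ (c , d) = (a + c , b + d)

mul : ℤ → O → O → O
mul D (a , b) (c , d) = (a * c + b * d * ωm D , a * d + b * c + b * d * ωt D)

sqrtD : ℤ → O
sqrtD D with D %ℕ 4 ℕ.≟ 1
... | yes _ = (- + 1 , + 2)
... | no  _ = (+ 0 , + 1)

Ideal : Set₁
Ideal = O → Set

gen2 : ℤ → O → O → Ideal
gen2 D a b z = Σ O λ α → Σ O λ β → z ≡ (mul D α a ⊕ mul D β b)

gen1 : ℤ → O → Ideal
gen1 D γ z = Σ O λ α → z ≡ mul D α γ

IsPrincipal : ℤ → Ideal → Set
IsPrincipal D I = Σ O λ γ → ∀ z → I z ⇔ gen1 D γ z

𝒫 : ℤ → ℕ → ℤ → Ideal
𝒫 D q n = gen2 D (ι (+ q)) (ι n ⊕ sqrtD D)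

form : ℤ → ℤ → ℕ → ℤ → ℤ → ℤ
form l n q x y = l * x * x + + 2 * n * x * y + + q * y * y

{-# OPTIONS --safe #-}
module Submission where

-- With ω² = tω + m as in Defs, δ·(a + bω) = (δa + tb) + b√D. Modulo 𝒫 we have √D ≡ -n, so an
-- element γ = a + bω of 𝒫 satisfies q ∣ δa + tb - nb =: yq, i.e. δγ = yq + b(n + √D), and then
--   δ² N(γ) = (yq + nb)² - D b² = q f(b, y).
-- If 𝒫 = (γ), then q ∣ N(γ), and q = μγ gives q = N(μ)·(N(γ)/q). Here N(μ) = ±1 is impossible,
-- since then (γ) = (q) would contain n + √D, so N(γ) = ±q and f(b, y) = ±δ². Conversely, if
-- f(x, y) = ±δ², then yq + x(n + √D) has norm ±δ²q and is δ times some γ ∈ 𝒫 with N(γ) = ±q; then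
-- q = ±γγ̄ and (n + √D)γ̄ ∈ (q) because N(n + √D) = n² - D ∈ (q), so 𝒫 = (γ). For D < 0 the form f
-- is positive semidefinite, which rules out the value -δ².

open import Defs
open import Data.Nat as ℕ using (ℕ)
open import Data.Nat.Primality using (Prime)
open import Data.Integer using (ℤ; +_; _+_; _-_; _*_; -_; _<_)
open import Data.Integer.Divisibility using (_∣_)
open import Data.Product using (Σ; _×_; _,_)
open import Data.Sum using (_⊎_)
open import Relation.Nullary using (¬_)
open import Relation.Binary.PropositionalEquality using (_≡_; _≢_)
open import Function.Bundles using (_⇔_)

open import Data.Empty using (⊥-elim)
open import Data.Integer using (NonZero; ∣_∣; _≤_; -[1+_]; +≤+; +<+; -<+; positive)
open import Data.Integer.DivMod using (_%ℕ_; _/ℕ_; a≡a%ℕn+[a/ℕn]*n; n%ℕd<d)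
import Data.Integer.Divisibility.Signed as S
open import Data.Integer.Divisibility.Signed using (divides)
import Data.Integer.Properties as ℤ
open import Algebra.Properties.CommutativeSemigroup ℤ.+-commutativeSemigroup using (interchange)
open import Data.Integer.Tactic.RingSolver using (solve; solve-∀)
open import Data.List using (_∷_; [])
import Data.Nat.DivMod as ℕ
import Data.Nat.Divisibility as ℕ
open import Data.Nat.Primality using (prime[2]; ¬prime[1]; euclidsLemma; prime⇒irreducible; prime⇒nonZero)
import Data.Nat.Properties as ℕ
open import Data.Product using (proj₁; proj₂)
open import Data.Sum using (inj₁; inj₂; [_,_]′; map₂)
open import Function.Base using (id)
open import Function.Bundles using (mk⇔; Equivalence)
open import Relation.Binary.PropositionalEquality using (refl; sym; trans; cong; cong₂; subst; module ≡-Reasoning)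
open import Relation.Nullary using (yes; no)

odd-prime : ∀ {q} → Prime q → q ≢ 2 → Σ ℤ λ k → + q ≡ + 2 * k + + 1
odd-prime {q} q-prime q≢2 = + (q ℕ./ 2) , (begin
  + q                           ≡⟨ cong +_ (ℕ.m≡m%n+[m/n]*n q 2) ⟩
  + (q ℕ.% 2 ℕ.+ q ℕ./ 2 ℕ.* 2) ≡⟨ cong (λ r → + (r ℕ.+ q ℕ./ 2 ℕ.* 2)) q%2≡1 ⟩
  + 1 + + (q ℕ./ 2 ℕ.* 2)       ≡⟨ cong (λ x → + 1 + x) (ℤ.pos-* (q ℕ./ 2) 2) ⟩
  + 1 + + (q ℕ./ 2) * + 2       ≡⟨ ℤ.+-comm (+ 1) (+ (q ℕ./ 2) * + 2) ⟩
  + (q ℕ./ 2) * + 2 + + 1       ≡⟨ cong (_+ + 1) (ℤ.*-comm (+ (q ℕ./ 2)) (+ 2)) ⟩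
  + 2 * + (q ℕ./ 2) + + 1       ∎)
  where
  open ≡-Reasoning
  2∤q : ¬ (2 ℕ.∣ q)
  2∤q 2∣q = [ (λ ()) , (λ 2≡q → q≢2 (sym 2≡q)) ]′ (prime⇒irreducible q-prime 2∣q)
  q%2≡1 : q ℕ.% 2 ≡ 1
  q%2≡1 with q ℕ.% 2 | ℕ.m%n<n q 2 | ℕ.m%n≡0⇒n∣m q 2
  ... | 0               | _                  | 2∣q = ⊥-elim (2∤q (2∣q refl))
  ... | 1               | _                  | _   = refl
  ... | ℕ.suc (ℕ.suc _) | ℕ.s≤s (ℕ.s≤s ()) | _

prime-factor-unit : ∀ {p} → Prime p → ∀ a b → + p ≡ a * b → ∣ a ∣ ≡ 1 ⊎ ∣ b ∣ ≡ 1
prime-factor-unit {p} p-prime a b p≡ab =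
  map₂ ∣a∣≡p⇒∣b∣≡1 (prime⇒irreducible p-prime (ℕ.divides ∣ b ∣ (trans p≡∣a∣∣b∣ (ℕ.*-comm ∣ a ∣ ∣ b ∣))))
  where
  p≡∣a∣∣b∣ : p ≡ ∣ a ∣ ℕ.* ∣ b ∣
  p≡∣a∣∣b∣ = trans (cong ∣_∣ p≡ab) (ℤ.abs-* a b)
  ∣a∣≡p⇒∣b∣≡1 : ∣ a ∣ ≡ p → ∣ b ∣ ≡ 1
  ∣a∣≡p⇒∣b∣≡1 ∣a∣≡p = sym (ℕ.*-cancelˡ-≡ 1 ∣ b ∣ p {{prime⇒nonZero p-prime}}
    (trans (ℕ.*-identityʳ p) (trans p≡∣a∣∣b∣ (cong (ℕ._* ∣ b ∣) ∣a∣≡p))))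

∣u∣≡1⇒u*u≡1 : ∀ u → ∣ u ∣ ≡ 1 → u * u ≡ + 1
∣u∣≡1⇒u*u≡1 (+ _)     refl = refl
∣u∣≡1⇒u*u≡1 -[1+ 0 ] refl = refl

unit-cases : ∀ {f c u} → ∣ u ∣ ≡ 1 → f ≡ c * u → (f ≡ c) ⊎ (f ≡ - c)
unit-cases {c = c} {+ _}       refl f≡c*1  = inj₁ (trans f≡c*1 (ℤ.*-identityʳ c))
unit-cases {c = c} { -[1+ 0 ]} refl f≡c*-1 = inj₂ (trans f≡c*-1 (trans (ℤ.*-comm c -[1+ 0 ]) (ℤ.-1*i≡-i c)))

±-as-unit : ∀ {f c} → (f ≡ c) ⊎ (f ≡ - c) → Σ ℤ λ u → u * u ≡ + 1 × f ≡ c * u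
±-as-unit {c = c} (inj₁ f≡c)  = + 1 , refl , trans f≡c (sym (ℤ.*-identityʳ c))
±-as-unit {c = c} (inj₂ f≡-c) = -[1+ 0 ] , refl , trans f≡-c (sym (trans (ℤ.*-comm c -[1+ 0 ]) (ℤ.-1*i≡-i c)))

square-nonNeg : ∀ a → + 0 ≤ a * a
square-nonNeg (+ n)    = subst (+ 0 ≤_) (sym (ℤ.+◃n≡+n (n ℕ.* n))) (+≤+ ℕ.z≤n)
square-nonNeg -[1+ n ] = +≤+ ℕ.z≤n

norm-nonNeg : ∀ {D} → D < + 0 → ∀ a b → + 0 ≤ a * a - D * (b * b)
norm-nonNeg {+ _}      (+<+ ())
norm-nonNeg { -[1+ d ]} _ a b = ℤ.+-mono-≤ (square-nonNeg a) (subst (+ 0 ≤_) -Db²≡ 0≤-Db²)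
  where
  0≤-Db² : + 0 ≤ + ℕ.suc d * (b * b)
  0≤-Db² = subst (_≤ + ℕ.suc d * (b * b)) (ℤ.*-zeroʳ (+ ℕ.suc d))
    (ℤ.*-monoˡ-≤-nonNeg (+ ℕ.suc d) (square-nonNeg b))
  -Db²≡ : + ℕ.suc d * (b * b) ≡ - (-[1+ d ] * (b * b))
  -Db²≡ = sym (ℤ.neg-distribˡ-* -[1+ d ] (b * b))

module RingOfIntegers (D : ℤ) where

  private
    t m : ℤ
    t = ωt D
    m = ωm D

  open ≡-Reasoning

  infixl 25 _·_
  _·_ : O → O → O
  _·_ = mul D

  N : O → ℤ
  N (a , b) = a * a + t * a * b - m * b * b

  conj : O → O
  conj (a , b) = (a + t * b , - b)

  ·-comm : ∀ x y → x · y ≡ y · x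
  ·-comm (a , b) (c , d) =
    cong₂ _,_ (solve (a ∷ b ∷ c ∷ d ∷ [])) (solve (a ∷ b ∷ c ∷ d ∷ []))

  ·-assoc : ∀ x y z → (x · y) · z ≡ x · (y · z)
  ·-assoc (a , b) (c , d) (e , f) = cong₂ _,_ (assoc₁ t m a b c d e f) (assoc₂ t m a b c d e f)
    where
    assoc₁ : ∀ t m a b c d e f →
      (a * c + b * d * m) * e + (a * d + b * c + b * d * t) * f * m
        ≡ a * (c * e + d * f * m) + b * (c * f + d * e + d * f * t) * m
    assoc₁ = solve-∀
    assoc₂ : ∀ t m a b c d e f →
      (a * c + b * d * m) * f + (a * d + b * c + b * d * t) * e + (a * d + b * c + b * d * t) * f * t
        ≡ a * (c * f + d * e + d * f * t) + b * (c * e + d * f * m) + b * (c * f + d * e + d * f * t) * t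
    assoc₂ = solve-∀

  ·-distribˡ-⊕ : ∀ x y z → x · (y ⊕ z) ≡ x · y ⊕ x · z
  ·-distribˡ-⊕ (a , b) (c , d) (e , f) = cong₂ _,_ (distrib₁ t m a b c d e f) (distrib₂ t m a b c d e f)
    where
    distrib₁ : ∀ t m a b c d e f →
      a * (c + e) + b * (d + f) * m ≡ (a * c + b * d * m) + (a * e + b * f * m)
    distrib₁ = solve-∀
    distrib₂ : ∀ t m a b c d e f →
      a * (d + f) + b * (c + e) + b * (d + f) * t
        ≡ (a * d + b * c + b * d * t) + (a * f + b * e + b * f * t)
    distrib₂ = solve-∀

  ·-distribʳ-⊕ : ∀ x y z → (x ⊕ y) · z ≡ x · z ⊕ y · z
  ·-distribʳ-⊕ x y z = begin
    (x ⊕ y) · z   ≡⟨ ·-comm (x ⊕ y) z ⟩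
    z · (x ⊕ y)   ≡⟨ ·-distribˡ-⊕ z x y ⟩
    z · x ⊕ z · y ≡⟨ cong₂ _⊕_ (·-comm z x) (·-comm z y) ⟩
    x · z ⊕ y · z ∎

  x·yz≡y·xz : ∀ x y z → x · (y · z) ≡ y · (x · z)
  x·yz≡y·xz x y z = trans (sym (·-assoc x y z)) (trans (cong (_· z) (·-comm x y)) (·-assoc y x z))

  ·-conj : ∀ x → x · conj x ≡ ι (N x)
  ·-conj (a , b) = cong₂ _,_ (conj₁ t m a b) (conj₂ t m a b)
    where
    conj₁ : ∀ t m a b → a * (a + t * b) + b * - b * m ≡ a * a + t * a * b - m * b * b
    conj₁ = solve-∀
    conj₂ : ∀ t m a b → a * - b + b * (a + t * b) + b * - b * t ≡ + 0
    conj₂ = solve-∀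

  conj-·-self : ∀ x → conj x · x ≡ ι (N x)
  conj-·-self x = trans (·-comm (conj x) x) (·-conj x)

  conj-· : ∀ x y → conj (x · y) ≡ conj x · conj y
  conj-· (a , b) (c , d) = cong₂ _,_ (conj-·₁ t m a b c d) (conj-·₂ t m a b c d)
    where
    conj-·₁ : ∀ t m a b c d →
      a * c + b * d * m + t * (a * d + b * c + b * d * t)
        ≡ (a + t * b) * (c + t * d) + - b * - d * m
    conj-·₁ = solve-∀
    conj-·₂ : ∀ t m a b c d →
      - (a * d + b * c + b * d * t) ≡ (a + t * b) * - d + - b * (c + t * d) + - b * - d * t
    conj-·₂ = solve-∀

  conj-⊕ : ∀ x y → conj (x ⊕ y) ≡ conj x ⊕ conj y
  conj-⊕ (a , b) (c , d) = cong₂ _,_ (conj-⊕₁ t a b c d) (ℤ.neg-distrib-+ b d)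
    where
    conj-⊕₁ : ∀ t a b c d → a + c + t * (b + d) ≡ (a + t * b) + (c + t * d)
    conj-⊕₁ = solve-∀

  conj-ι : ∀ a → conj (ι a) ≡ ι a
  conj-ι a = cong (_, + 0) (trans (cong (λ e → a + e) (ℤ.*-zeroʳ t)) (ℤ.+-identityʳ a))

  N-· : ∀ x y → N (x · y) ≡ N x * N y
  N-· (a , b) (c , d) = norm-mult t m a b c d
    where
    norm-mult : ∀ t m a b c d →
      (a * c + b * d * m) * (a * c + b * d * m) + t * (a * c + b * d * m) * (a * d + b * c + b * d * t)
        - m * (a * d + b * c + b * d * t) * (a * d + b * c + b * d * t)
        ≡ (a * a + t * a * b - m * b * b) * (c * c + t * c * d - m * d * d)
    norm-mult = solve-∀

  ι-· : ∀ a b c → ι a · (b , c) ≡ (a * b , a * c)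
  ι-· a b c = cong₂ _,_ (ℤ.+-identityʳ (a * b)) (trans (ℤ.+-identityʳ _) (ℤ.+-identityʳ (a * c)))

  ι-ι : ∀ a b → ι a · ι b ≡ ι (a * b)
  ι-ι a b = trans (ι-· a b (+ 0)) (cong (a * b ,_) (ℤ.*-zeroʳ a))

  ι-·-ι : ∀ a b x → ι a · (ι b · x) ≡ ι (a * b) · x
  ι-·-ι a b x = trans (sym (·-assoc (ι a) (ι b) x)) (cong (_· x) (ι-ι a b))

  ι-⊕-· : ∀ a b x → ι a · x ⊕ ι b · x ≡ ι (a + b) · x
  ι-⊕-· a b x = sym (·-distribʳ-⊕ (ι a) (ι b) x)

  ·-identityˡ : ∀ x → ι (+ 1) · x ≡ x
  ·-identityˡ (a , b) = trans (ι-· (+ 1) a b) (cong₂ _,_ (ℤ.*-identityˡ a) (ℤ.*-identityˡ b))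

  ι-cancel : ∀ a .{{_ : NonZero a}} {x y} → ι a · x ≡ ι a · y → x ≡ y
  ι-cancel a {b , c} {d , e} eq =
    cong₂ _,_ (ℤ.*-cancelˡ-≡ a b d (cong proj₁ eq′)) (ℤ.*-cancelˡ-≡ a c e (cong proj₂ eq′))
    where
    eq′ : (a * b , a * c) ≡ (a * d , a * e)
    eq′ = trans (sym (ι-· a b c)) (trans eq (ι-· a d e))

  N-ι : ∀ a → N (ι a) ≡ a * a
  N-ι a = norm-ι t m a
    where
    norm-ι : ∀ t m a → a * a + t * a * + 0 - m * + 0 * + 0 ≡ a * a
    norm-ι = solve-∀

  ι-unit-involutive : ∀ u → u * u ≡ + 1 → ∀ x → ι u · (ι u · x) ≡ x
  ι-unit-involutive u u²≡1 x = trans (ι-·-ι u u x) (trans (cong (λ c → ι c · x) u²≡1) (·-identityˡ x))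

  gen2-·-closed : ∀ {u v z} w → gen2 D u v z → gen2 D u v (w · z)
  gen2-·-closed {u} {v} w (α , β , refl) = w · α , w · β , (begin
    w · (α · u ⊕ β · v)       ≡⟨ ·-distribˡ-⊕ w (α · u) (β · v) ⟩
    w · (α · u) ⊕ w · (β · v) ≡⟨ cong₂ _⊕_ (sym (·-assoc w α u)) (sym (·-assoc w β v)) ⟩
    w · α · u ⊕ w · β · v     ∎)

  gen2-⊕-closed : ∀ {u v y z} → gen2 D u v y → gen2 D u v z → gen2 D u v (y ⊕ z)
  gen2-⊕-closed {u} {v} (α , β , refl) (α′ , β′ , refl) = α ⊕ α′ , β ⊕ β′ , (begin
    (α · u ⊕ β · v) ⊕ (α′ · u ⊕ β′ · v) ≡⟨ ⊕-interchange (α · u) (β · v) (α′ · u) (β′ · v) ⟩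
    (α · u ⊕ α′ · u) ⊕ (β · v ⊕ β′ · v) ≡⟨ sym (cong₂ _⊕_ (·-distribʳ-⊕ α α′ u) (·-distribʳ-⊕ β β′ v)) ⟩
    (α ⊕ α′) · u ⊕ (β ⊕ β′) · v         ∎)
    where
    ⊕-interchange : ∀ w x y z → (w ⊕ x) ⊕ (y ⊕ z) ≡ (w ⊕ y) ⊕ (x ⊕ z)
    ⊕-interchange (a , b) (c , d) (e , f) (g , h) = cong₂ _,_ (interchange a c e g) (interchange b d f h)

  gen2-∋₁ : ∀ {u v} → gen2 D u v u
  gen2-∋₁ {u@(a , b)} {v} = ι (+ 1) , ι (+ 0) , sym (begin
    ι (+ 1) · u ⊕ ι (+ 0) · v ≡⟨ cong (_⊕ ι (+ 0) · v) (·-identityˡ u) ⟩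
    u ⊕ ι (+ 0) · v           ≡⟨ cong₂ _,_ (ℤ.+-identityʳ a) (ℤ.+-identityʳ b) ⟩
    u                         ∎)

  gen2-∋₂ : ∀ {u v} → gen2 D u v v
  gen2-∋₂ {u} {v@(a , b)} = ι (+ 0) , ι (+ 1) , sym (begin
    ι (+ 0) · u ⊕ ι (+ 1) · v ≡⟨ cong (ι (+ 0) · u ⊕_) (·-identityˡ v) ⟩
    ι (+ 0) · u ⊕ v           ≡⟨ cong₂ _,_ (ℤ.+-identityˡ a) (ℤ.+-identityˡ b) ⟩
    v                         ∎)

  gen1⊆gen2 : ∀ {u v γ z} → gen2 D u v γ → gen1 D γ z → gen2 D u v z
  gen1⊆gen2 γ∈I (α , refl) = gen2-·-closed α γ∈I

  gen2⊆gen1 : ∀ {u v γ z} → gen1 D γ u → gen1 D γ v → gen2 D u v z → gen1 D γ z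
  gen2⊆gen1 {γ = γ} (μ , refl) (ν , refl) (α , β , refl) = α · μ ⊕ β · ν , (begin
    α · (μ · γ) ⊕ β · (ν · γ) ≡⟨ cong₂ _⊕_ (sym (·-assoc α μ γ)) (sym (·-assoc β ν γ)) ⟩
    α · μ · γ ⊕ β · ν · γ     ≡⟨ sym (·-distribʳ-⊕ (α · μ) (β · ν) γ) ⟩
    (α · μ ⊕ β · ν) · γ       ∎)

  N≡ua⇒a∈⟨γ⟩ : ∀ {a} u γ → u * u ≡ + 1 → N γ ≡ u * a → gen1 D γ (ι a)
  N≡ua⇒a∈⟨γ⟩ {a} u γ u²≡1 Nγ≡ua = ι u · conj γ , sym (begin
    ι u · conj γ · γ   ≡⟨ ·-assoc (ι u) (conj γ) γ ⟩
    ι u · (conj γ · γ) ≡⟨ cong (ι u ·_) (conj-·-self γ) ⟩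
    ι u · ι (N γ)      ≡⟨ cong (λ c → ι u · ι c) Nγ≡ua ⟩
    ι u · ι (u * a)    ≡⟨ cong (ι u ·_) (sym (ι-ι u a)) ⟩
    ι u · (ι u · ι a)  ≡⟨ ι-unit-involutive u u²≡1 (ι a) ⟩
    ι a                ∎)

  π·conjγ∈⟨a⟩ : ∀ {a π γ} l → gen2 D (ι a) π γ → N π ≡ l * a → gen1 D (ι a) (π · conj γ)
  π·conjγ∈⟨a⟩ {a} {π} l (α , β , refl) Nπ≡la = π · conj α ⊕ conj β · ι l , (begin
    π · conj (α · ι a ⊕ β · π)
      ≡⟨ cong (π ·_) (conj-⊕ (α · ι a) (β · π)) ⟩
    π · (conj (α · ι a) ⊕ conj (β · π))
      ≡⟨ cong (π ·_) (cong₂ _⊕_ (conj-· α (ι a)) (conj-· β π)) ⟩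
    π · (conj α · conj (ι a) ⊕ conj β · conj π)
      ≡⟨ cong (λ c → π · (conj α · c ⊕ conj β · conj π)) (conj-ι a) ⟩
    π · (conj α · ι a ⊕ conj β · conj π)
      ≡⟨ ·-distribˡ-⊕ π (conj α · ι a) (conj β · conj π) ⟩
    π · (conj α · ι a) ⊕ π · (conj β · conj π)
      ≡⟨ cong₂ _⊕_ (sym (·-assoc π (conj α) (ι a))) (x·yz≡y·xz π (conj β) (conj π)) ⟩
    π · conj α · ι a ⊕ conj β · (π · conj π)
      ≡⟨ cong (λ c → π · conj α · ι a ⊕ conj β · c) (trans (·-conj π) (cong ι Nπ≡la)) ⟩
    π · conj α · ι a ⊕ conj β · ι (l * a)
      ≡⟨ cong (λ c → π · conj α · ι a ⊕ conj β · c) (sym (ι-ι l a)) ⟩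
    π · conj α · ι a ⊕ conj β · (ι l · ι a)
      ≡⟨ cong (π · conj α · ι a ⊕_) (sym (·-assoc (conj β) (ι l) (ι a))) ⟩
    π · conj α · ι a ⊕ conj β · ι l · ι a
      ≡⟨ sym (·-distribʳ-⊕ (π · conj α) (conj β · ι l) (ι a)) ⟩
    (π · conj α ⊕ conj β · ι l) · ι a ∎)

  principal-by-norm : ∀ a .{{_ : NonZero a}} u l {π γ} → gen2 D (ι a) π γ →
    u * u ≡ + 1 → N γ ≡ u * a → N π ≡ l * a → IsPrincipal D (gen2 D (ι a) π)
  principal-by-norm a u l {π} {γ} γ∈I u²≡1 Nγ≡ua Nπ≡la =
    γ , λ z → mk⇔ (gen2⊆gen1 (N≡ua⇒a∈⟨γ⟩ u γ u²≡1 Nγ≡ua) π∈⟨γ⟩) (gen1⊆gen2 γ∈I)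
    where
    w : O
    w = proj₁ (π·conjγ∈⟨a⟩ l γ∈I Nπ≡la)
    wγ≡uπ : w · γ ≡ ι u · π
    wγ≡uπ = ι-cancel a (begin
      ι a · (w · γ)    ≡⟨ sym (·-assoc (ι a) w γ) ⟩
      ι a · w · γ      ≡⟨ cong (_· γ) (·-comm (ι a) w) ⟩
      w · ι a · γ      ≡⟨ cong (_· γ) (sym (proj₂ (π·conjγ∈⟨a⟩ l γ∈I Nπ≡la))) ⟩
      π · conj γ · γ   ≡⟨ ·-assoc π (conj γ) γ ⟩
      π · (conj γ · γ) ≡⟨ cong (π ·_) (conj-·-self γ) ⟩
      π · ι (N γ)      ≡⟨ cong (λ c → π · ι c) (trans Nγ≡ua (ℤ.*-comm u a)) ⟩
      π · ι (a * u)    ≡⟨ ·-comm π (ι (a * u)) ⟩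
      ι (a * u) · π    ≡⟨ sym (ι-·-ι a u π) ⟩
      ι a · (ι u · π)  ∎)
    π∈⟨γ⟩ : gen1 D γ π
    π∈⟨γ⟩ = ι u · w , (begin
      π               ≡⟨ sym (ι-unit-involutive u u²≡1 π) ⟩
      ι u · (ι u · π) ≡⟨ cong (ι u ·_) (sym wγ≡uπ) ⟩
      ι u · (w · γ)   ≡⟨ sym (·-assoc (ι u) w γ) ⟩
      ι u · w · γ     ∎)

  unit-cofactor⇒⟨γ⟩⊆⟨a⟩ : ∀ {a γ z} μ → ι a ≡ μ · γ → N μ * N μ ≡ + 1 → gen1 D γ z → gen1 D (ι a) z
  unit-cofactor⇒⟨γ⟩⊆⟨a⟩ {a} {γ} μ ιa≡μγ Nμ²≡1 (α , refl) = α · μ′ , (begin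
    α · γ          ≡⟨ cong (α ·_) γ≡μ′a ⟩
    α · (μ′ · ι a) ≡⟨ sym (·-assoc α μ′ (ι a)) ⟩
    α · μ′ · ι a   ∎)
    where
    μ′ : O
    μ′ = ι (N μ) · conj μ
    γ≡μ′a : γ ≡ μ′ · ι a
    γ≡μ′a = sym (begin
      μ′ · ι a                     ≡⟨ cong (μ′ ·_) ιa≡μγ ⟩
      μ′ · (μ · γ)                 ≡⟨ ·-assoc (ι (N μ)) (conj μ) (μ · γ) ⟩
      ι (N μ) · (conj μ · (μ · γ)) ≡⟨ cong (ι (N μ) ·_) (sym (·-assoc (conj μ) μ γ)) ⟩
      ι (N μ) · (conj μ · μ · γ)   ≡⟨ cong (λ c → ι (N μ) · (c · γ)) (conj-·-self μ) ⟩
      ι (N μ) · (ι (N μ) · γ)      ≡⟨ ι-unit-involutive (N μ) Nμ²≡1 γ ⟩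
      γ                            ∎)

-- D - 1 = r + 4m with 0 ≤ r < 4 (floor division), and 4 ∣ D - 1 forces r = 0.
D≡4m+1 : ∀ D → D %ℕ 4 ≡ 1 → D ≡ + 4 * ((D - + 1) /ℕ 4) + + 1
D≡4m+1 D D%4≡1 = begin
  D                   ≡⟨ i≡i-1+1 D ⟩
  D - + 1 + + 1       ≡⟨ cong (_+ + 1) (a≡a%ℕn+[a/ℕn]*n (D - + 1) 4) ⟩
  + r + m * + 4 + + 1 ≡⟨ cong (λ s → + s + m * + 4 + + 1) r≡0 ⟩
  + 0 + m * + 4 + + 1 ≡⟨ reorder m ⟩
  + 4 * m + + 1       ∎
  where
  open ≡-Reasoning
  i≡i-1+1 : ∀ i → i ≡ i - + 1 + + 1
  i≡i-1+1 = solve-∀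
  reorder : ∀ m → + 0 + m * + 4 + + 1 ≡ + 4 * m + + 1
  reorder = solve-∀
  1+i-1≡i : ∀ i → + 1 + i - + 1 ≡ i
  1+i-1≡i = solve-∀
  m : ℤ
  m = (D - + 1) /ℕ 4
  r : ℕ
  r = (D - + 1) %ℕ 4
  4∣D-1 : + 4 S.∣ D - + 1
  4∣D-1 = divides (D /ℕ 4) (begin
    D - + 1                         ≡⟨ cong (_- + 1) (a≡a%ℕn+[a/ℕn]*n D 4) ⟩
    + (D %ℕ 4) + D /ℕ 4 * + 4 - + 1 ≡⟨ cong (λ s → + s + D /ℕ 4 * + 4 - + 1) D%4≡1 ⟩
    + 1 + D /ℕ 4 * + 4 - + 1        ≡⟨ 1+i-1≡i (D /ℕ 4 * + 4) ⟩
    D /ℕ 4 * + 4                    ∎)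
  4∣r : 4 ℕ.∣ r
  4∣r = S.∣⇒∣ᵤ (S.∣m+n∣n⇒∣m {m = + r}
    (subst (+ 4 S.∣_) (a≡a%ℕn+[a/ℕn]*n (D - + 1) 4) 4∣D-1) (S.∣n⇒∣m*n m S.∣-refl))
  r≡0 : r ≡ 0
  r≡0 = trans (sym (ℕ.m<n⇒m%n≡m (n%ℕd<d (D - + 1) 4))) (ℕ.n∣m⇒m%n≡0 r 4 4∣r)

-- The two integral bases of Defs (ω² = t ω + m); matching on them turns the case split of Defs
-- into polynomial identities.
data Basis : ℤ → ℤ → ℤ → ℤ → Set where
  ω≡√D       : ∀ {D} → Basis D (+ 0) D (+ 1)
  ω≡[1+√D]/2 : ∀ {m} → Basis (+ 4 * m + + 1) (+ 1) m (+ 2)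

basis : ∀ D → Basis D (ωt D) (ωm D) (δ D)
basis D with D %ℕ 4 ℕ.≟ 1
... | no  _      = ω≡√D
... | yes D%4≡1 = subst (λ d → Basis d (+ 1) ((D - + 1) /ℕ 4) (+ 2)) (sym (D≡4m+1 D D%4≡1)) ω≡[1+√D]/2

module _ {D t m δ : ℤ} where

  basis-norm : Basis D t m δ → ∀ a b →
    δ * δ * (a * a + t * a * b - m * b * b) ≡ (δ * a + t * b) * (δ * a + t * b) - D * (b * b)
  basis-norm ω≡√D       a b = solve (a ∷ b ∷ D ∷ [])
  basis-norm ω≡[1+√D]/2 a b = solve (a ∷ b ∷ m ∷ [])

  basis-norm-π : Basis D t m δ → ∀ n → (n - t) * (n - t) + t * (n - t) * δ - m * δ * δ ≡ n * n - D
  basis-norm-π ω≡√D       n = solve (n ∷ D ∷ [])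
  basis-norm-π ω≡[1+√D]/2 n = solve (n ∷ m ∷ [])

  basis-red-π : Basis D t m δ → ∀ n b₀ b₁ →
    δ * (b₀ * (n - t) + b₁ * δ * m) + t * (b₀ * δ + b₁ * (n - t) + b₁ * δ * t)
      - n * (b₀ * δ + b₁ * (n - t) + b₁ * δ * t)
      ≡ b₁ * (D - n * n)
  basis-red-π ω≡√D       n b₀ b₁ = solve (n ∷ b₀ ∷ b₁ ∷ D ∷ [])
  basis-red-π ω≡[1+√D]/2 n b₀ b₁ = solve (n ∷ b₀ ∷ b₁ ∷ m ∷ [])

  -- For D = 4m + 1: 4 ∣ a² - Db² gives 2 ∣ (a - b)(a + b), and a ± b have the same parity.
  basis-halve : Basis D t m δ → ∀ a b → δ * δ S.∣ a * a - D * (b * b) → δ S.∣ a - t * b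
  basis-halve ω≡√D       a b _   = divides (a - + 0 * b) (sym (ℤ.*-identityʳ _))
  basis-halve ω≡[1+√D]/2 a b 4∣N = subst (+ 2 S.∣_) (cong (λ c → a - c) (sym (ℤ.*-identityˡ b)))
    ([ S.∣ᵤ⇒∣ , 2∣a+b⇒2∣a-b ]′ (euclidsLemma ∣ a - b ∣ ∣ a + b ∣ prime[2] 2∣∣a-b∣∣a+b∣))
    where
    N+4mb²≡[a-b][a+b] : a * a - (+ 4 * m + + 1) * (b * b) + + 2 * (+ 2 * m * (b * b)) ≡ (a - b) * (a + b)
    N+4mb²≡[a-b][a+b] = solve (a ∷ b ∷ m ∷ [])
    2∣[a-b][a+b] : + 2 S.∣ (a - b) * (a + b)
    2∣[a-b][a+b] = subst (+ 2 S.∣_) N+4mb²≡[a-b][a+b]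
      (S.∣m∣n⇒∣m+n (S.∣-trans (divides (+ 2) refl) 4∣N) (S.∣m⇒∣m*n (+ 2 * m * (b * b)) S.∣-refl))
    2∣∣a-b∣∣a+b∣ : 2 ℕ.∣ ∣ a - b ∣ ℕ.* ∣ a + b ∣
    2∣∣a-b∣∣a+b∣ = subst (2 ℕ.∣_) (ℤ.abs-* (a - b) (a + b)) (S.∣⇒∣ᵤ 2∣[a-b][a+b])
    a+b-2b≡a-b : a + b - + 2 * b ≡ a - b
    a+b-2b≡a-b = solve (a ∷ b ∷ [])
    2∣a+b⇒2∣a-b : 2 ℕ.∣ ∣ a + b ∣ → + 2 S.∣ a - b
    2∣a+b⇒2∣a-b 2∣a+b =
      subst (+ 2 S.∣_) a+b-2b≡a-b (S.∣m∣n⇒∣m-n (S.∣ᵤ⇒∣ {i = a + b} 2∣a+b) (S.∣m⇒∣m*n b S.∣-refl))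

  basis-δ-inverse : Basis D t m δ → ∀ k → Σ ℤ λ h → + 2 * k + + 1 S.∣ δ * h - + 1
  basis-δ-inverse ω≡√D       k = + 1 , divides (+ 0) refl
  basis-δ-inverse ω≡[1+√D]/2 k = k + + 1 , divides (+ 1) (solve (k ∷ []))

  basis-δ≢0 : Basis D t m δ → NonZero δ
  basis-δ≢0 ω≡√D       = _
  basis-δ≢0 ω≡[1+√D]/2 = _

  basis-neg-δ²<0 : Basis D t m δ → - (δ * δ) < + 0
  basis-neg-δ²<0 ω≡√D       = -<+
  basis-neg-δ²<0 ω≡[1+√D]/2 = -<+

module PrimeIdeal (D : ℤ) {q : ℕ} (q-prime : Prime q) (q≢2 : q ≢ 2)
                  (n l : ℤ) (n²-D≡lq : n * n - D ≡ l * + q) where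

  open RingOfIntegers D
  open ≡-Reasoning

  private
    B : Basis D (ωt D) (ωm D) (δ D)
    B = basis D

  instance
    q≢0 : NonZero (+ q)
    q≢0 = prime⇒nonZero q-prime

    δ≢0 : NonZero (δ D)
    δ≢0 = basis-δ≢0 B

  P : Ideal
  P = 𝒫 D q n

  π : O
  π = ι n ⊕ sqrtD D

  π≡ : ι n ⊕ sqrtD D ≡ (n - ωt D , δ D)
  π≡ with D %ℕ 4 ℕ.≟ 1
  ... | yes _ = refl
  ... | no  _ = refl

  q∈P : P (ι (+ q))
  q∈P = gen2-∋₁ {ι (+ q)} {π}

  π∈P : P π
  π∈P = gen2-∋₂ {ι (+ q)} {π}

  -- δ·(a + bω) = re (a , b) + b√D, and √D ≡ -n modulo 𝒫.
  re : O → ℤ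
  re (a , b) = δ D * a + ωt D * b

  red : O → ℤ
  red z = re z - n * proj₂ z

  Represents±δ² : Set
  Represents±δ² = Σ ℤ λ x → Σ ℤ λ y → (form l n q x y ≡ δ D * δ D) ⊎ (form l n q x y ≡ - (δ D * δ D))

  δ-inverse : Σ ℤ λ h → + q S.∣ δ D * h - + 1
  δ-inverse with odd-prime q-prime q≢2
  ... | k , q≡2k+1 = subst (λ c → Σ ℤ λ h → c S.∣ δ D * h - + 1) (sym q≡2k+1) (basis-δ-inverse B k)

  q∣δa⇒q∣a : ∀ {a} → + q S.∣ δ D * a → + q S.∣ a
  q∣δa⇒q∣a {a} q∣δa with δ-inverse
  ... | h , q∣δh-1 =
    subst (+ q S.∣_) (cancel (δ D) h a) (S.∣m∣n⇒∣m-n (S.∣n⇒∣m*n h q∣δa) (S.∣m⇒∣m*n a q∣δh-1))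
    where
    cancel : ∀ d h a → h * (d * a) - (d * h - + 1) * a ≡ a
    cancel = solve-∀

  q∤δ : ¬ (+ q S.∣ δ D)
  q∤δ q∣δ = ¬prime[1] (subst Prime (ℕ.∣1⇒≡1 (S.∣⇒∣ᵤ q∣1)) q-prime)
    where
    q∣1 : + q S.∣ + 1
    q∣1 = q∣δa⇒q∣a (subst (+ q S.∣_) (sym (ℤ.*-identityʳ (δ D))) q∣δ)

  δz∈P⇒z∈P : ∀ {z} → P (ι (δ D) · z) → P z
  δz∈P⇒z∈P {z} δz∈P with δ-inverse
  ... | h , divides k δh-1≡kq =
    subst P z≡ (gen2-⊕-closed (gen2-·-closed (ι h) δz∈P) (gen2-·-closed (ι (- k)) (gen2-·-closed z q∈P)))
    where
    hδ-kq≡1 : h * δ D + - k * + q ≡ + 1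
    hδ-kq≡1 = begin
      h * δ D + - k * + q           ≡⟨ rearrange (δ D) h k (+ q) ⟩
      δ D * h - + 1 - k * + q + + 1 ≡⟨ cong (λ c → c - k * + q + + 1) δh-1≡kq ⟩
      k * + q - k * + q + + 1       ≡⟨ cong (_+ + 1) (ℤ.+-inverseʳ (k * + q)) ⟩
      + 1                           ∎
      where
      rearrange : ∀ d h k c → h * d + - k * c ≡ d * h - + 1 - k * c + + 1
      rearrange = solve-∀
    z≡ : ι h · (ι (δ D) · z) ⊕ ι (- k) · (z · ι (+ q)) ≡ z
    z≡ = begin
      ι h · (ι (δ D) · z) ⊕ ι (- k) · (z · ι (+ q))
        ≡⟨ cong (λ c → ι h · (ι (δ D) · z) ⊕ ι (- k) · c) (·-comm z (ι (+ q))) ⟩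
      ι h · (ι (δ D) · z) ⊕ ι (- k) · (ι (+ q) · z)
        ≡⟨ cong₂ _⊕_ (ι-·-ι h (δ D) z) (ι-·-ι (- k) (+ q) z) ⟩
      ι (h * δ D) · z ⊕ ι (- k * + q) · z
        ≡⟨ ι-⊕-· (h * δ D) (- k * + q) z ⟩
      ι (h * δ D + - k * + q) · z
        ≡⟨ cong (λ c → ι c · z) hδ-kq≡1 ⟩
      ι (+ 1) · z
        ≡⟨ ·-identityˡ z ⟩
      z ∎

  q∣D-n² : + q S.∣ D - n * n
  q∣D-n² = divides (- l) (begin
    D - n * n     ≡⟨ solve (D ∷ n ∷ []) ⟩
    - (n * n - D) ≡⟨ cong -_ n²-D≡lq ⟩
    - (l * + q)   ≡⟨ ℤ.neg-distribˡ-* l (+ q) ⟩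
    - l * + q     ∎)

  red-ι·⊕ : ∀ c x y → red (ι c · x ⊕ y) ≡ c * red x + red y
  red-ι·⊕ c (a , b) (e , f) = begin
    red (ι c · (a , b) ⊕ (e , f))   ≡⟨ cong (λ x → red (x ⊕ (e , f))) (ι-· c a b) ⟩
    red ((c * a , c * b) ⊕ (e , f)) ≡⟨ linear (δ D) (ωt D) n c a b e f ⟩
    c * red (a , b) + red (e , f)   ∎
    where
    linear : ∀ d t n c a b e f →
      d * (c * a + e) + t * (c * b + f) - n * (c * b + f)
        ≡ c * (d * a + t * b - n * b) + (d * e + t * f - n * f)
    linear = solve-∀

  red-·π : ∀ β → red (β · π) ≡ proj₂ β * (D - n * n)
  red-·π (b₀ , b₁) = trans (cong (λ p → red ((b₀ , b₁) · p)) π≡) (basis-red-π B n b₀ b₁)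

  ∈P⇒q∣red : ∀ {z} → P z → + q S.∣ red z
  ∈P⇒q∣red (α , β , refl) = subst (+ q S.∣_) (sym red≡) q∣q·redα+β₁[D-n²]
    where
    red≡ : red (α · ι (+ q) ⊕ β · π) ≡ + q * red α + proj₂ β * (D - n * n)
    red≡ = begin
      red (α · ι (+ q) ⊕ β · π)           ≡⟨ cong (λ x → red (x ⊕ β · π)) (·-comm α (ι (+ q))) ⟩
      red (ι (+ q) · α ⊕ β · π)           ≡⟨ red-ι·⊕ (+ q) α (β · π) ⟩
      + q * red α + red (β · π)           ≡⟨ cong (λ c → + q * red α + c) (red-·π β) ⟩
      + q * red α + proj₂ β * (D - n * n) ∎
    q∣q·redα+β₁[D-n²] : + q S.∣ + q * red α + proj₂ β * (D - n * n)
    q∣q·redα+β₁[D-n²] = S.∣m∣n⇒∣m+n (S.∣m⇒∣m*n (red α) S.∣-refl) (S.∣n⇒∣m*n (proj₂ β) q∣D-n²)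

  form-identity : ∀ x y → (y * + q + n * x) * (y * + q + n * x) - D * (x * x) ≡ + q * form l n q x y
  form-identity x y = begin
    (y * + q + n * x) * (y * + q + n * x) - D * (x * x)
      ≡⟨ expand (+ q) n D x y ⟩
    + q * (+ 2 * n * x * y + + q * y * y) + (n * n - D) * (x * x)
      ≡⟨ cong (λ c → + q * (+ 2 * n * x * y + + q * y * y) + c * (x * x)) n²-D≡lq ⟩
    + q * (+ 2 * n * x * y + + q * y * y) + l * + q * (x * x)
      ≡⟨ collect (+ q) n l x y ⟩
    + q * form l n q x y ∎
    where
    expand : ∀ c n D x y →
      (y * c + n * x) * (y * c + n * x) - D * (x * x) ≡ c * (+ 2 * n * x * y + c * y * y) + (n * n - D) * (x * x)
    expand = solve-∀
    collect : ∀ c n l x y →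
      c * (+ 2 * n * x * y + c * y * y) + l * c * (x * x) ≡ c * (l * x * x + + 2 * n * x * y + c * y * y)
    collect = solve-∀

  δ²N≡q·form : ∀ {z} y → red z ≡ y * + q → δ D * δ D * N z ≡ + q * form l n q (proj₂ z) y
  δ²N≡q·form {a , b} y red≡yq = begin
    δ D * δ D * N (a , b)                               ≡⟨ basis-norm B a b ⟩
    re (a , b) * re (a , b) - D * (b * b)               ≡⟨ cong (λ c → c * c - D * (b * b)) re≡ ⟩
    (y * + q + n * b) * (y * + q + n * b) - D * (b * b) ≡⟨ form-identity b y ⟩
    + q * form l n q b y                                ∎
    where
    i≡i-j+j : ∀ i j → i ≡ i - j + j
    i≡i-j+j = solve-∀
    re≡ : re (a , b) ≡ y * + q + n * b
    re≡ = trans (i≡i-j+j (re (a , b)) (n * b)) (cong (_+ n * b) red≡yq)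

  N-π : N π ≡ l * + q
  N-π = trans (cong N π≡) (trans (basis-norm-π B n) n²-D≡lq)

  ∈P⇒q∣N : ∀ {γ} → P γ → + q S.∣ N γ
  ∈P⇒q∣N {γ} γ∈P with ∈P⇒q∣red γ∈P
  ... | divides y red≡yq = q∣δa⇒q∣a (q∣δa⇒q∣a (divides (form l n q (proj₂ γ) y) (begin
    δ D * (δ D * N γ)            ≡⟨ sym (ℤ.*-assoc (δ D) (δ D) (N γ)) ⟩
    δ D * δ D * N γ              ≡⟨ δ²N≡q·form y red≡yq ⟩
    + q * form l n q (proj₂ γ) y ≡⟨ ℤ.*-comm (+ q) _ ⟩
    form l n q (proj₂ γ) y * + q ∎)))

  π∉⟨q⟩ : ¬ gen1 D (ι (+ q)) π
  π∉⟨q⟩ (w , π≡wq) = q∤δ (divides (proj₂ w) (begin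
    δ D                 ≡⟨ cong proj₂ (sym π≡) ⟩
    proj₂ π             ≡⟨ cong proj₂ (trans π≡wq (·-comm w (ι (+ q)))) ⟩
    proj₂ (ι (+ q) · w) ≡⟨ cong proj₂ (ι-· (+ q) (proj₁ w) (proj₂ w)) ⟩
    + q * proj₂ w       ≡⟨ ℤ.*-comm (+ q) (proj₂ w) ⟩
    proj₂ w * + q       ∎))

  generator∈ : ∀ {γ} → (∀ z → P z ⇔ gen1 D γ z) → P γ
  generator∈ {γ} P⇔⟨γ⟩ = Equivalence.from (P⇔⟨γ⟩ γ) (ι (+ 1) , sym (·-identityˡ γ))

  generator-norm : ∀ {γ} → (∀ z → P z ⇔ gen1 D γ z) → Σ ℤ λ k → ∣ k ∣ ≡ 1 × N γ ≡ k * + q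
  generator-norm {γ} P⇔⟨γ⟩ = norm-from (∈P⇒q∣N (generator∈ P⇔⟨γ⟩))
    where
    q∈⟨γ⟩ : gen1 D γ (ι (+ q))
    q∈⟨γ⟩ = Equivalence.to (P⇔⟨γ⟩ (ι (+ q))) q∈P
    μ : O
    μ = proj₁ q∈⟨γ⟩
    π∈⟨q⟩ : ∣ N μ ∣ ≡ 1 → gen1 D (ι (+ q)) π
    π∈⟨q⟩ ∣Nμ∣≡1 =
      unit-cofactor⇒⟨γ⟩⊆⟨a⟩ μ (proj₂ q∈⟨γ⟩) (∣u∣≡1⇒u*u≡1 (N μ) ∣Nμ∣≡1) (Equivalence.to (P⇔⟨γ⟩ π) π∈P)
    norm-from : + q S.∣ N γ → Σ ℤ λ k → ∣ k ∣ ≡ 1 × N γ ≡ k * + q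
    norm-from (divides k Nγ≡kq) = k , ∣k∣≡1 , Nγ≡kq
      where
      q≡Nμk : + q ≡ N μ * k
      q≡Nμk = ℤ.*-cancelʳ-≡ (+ q) (N μ * k) (+ q) (begin
        + q * + q       ≡⟨ sym (N-ι (+ q)) ⟩
        N (ι (+ q))     ≡⟨ cong N (proj₂ q∈⟨γ⟩) ⟩
        N (μ · γ)       ≡⟨ N-· μ γ ⟩
        N μ * N γ       ≡⟨ cong (N μ *_) Nγ≡kq ⟩
        N μ * (k * + q) ≡⟨ sym (ℤ.*-assoc (N μ) k (+ q)) ⟩
        N μ * k * + q   ∎)
      ∣k∣≡1 : ∣ k ∣ ≡ 1
      ∣k∣≡1 = [ (λ ∣Nμ∣≡1 → ⊥-elim (π∉⟨q⟩ (π∈⟨q⟩ ∣Nμ∣≡1))) , id ]′ (prime-factor-unit q-prime (N μ) k q≡Nμk)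

  principal⇒represents : IsPrincipal D P → Represents±δ²
  principal⇒represents (γ , P⇔⟨γ⟩) = represent (∈P⇒q∣red (generator∈ P⇔⟨γ⟩)) (generator-norm P⇔⟨γ⟩)
    where
    swap : ∀ c k d → c * (k * d) ≡ d * (c * k)
    swap = solve-∀
    represent : + q S.∣ red γ → (Σ ℤ λ k → ∣ k ∣ ≡ 1 × N γ ≡ k * + q) → Represents±δ²
    represent (divides y red≡yq) (k , ∣k∣≡1 , Nγ≡kq) = proj₂ γ , y , unit-cases ∣k∣≡1 f≡δ²k
      where
      f≡δ²k : form l n q (proj₂ γ) y ≡ δ D * δ D * k
      f≡δ²k = ℤ.*-cancelˡ-≡ (+ q) _ _ (begin
        + q * form l n q (proj₂ γ) y ≡⟨ sym (δ²N≡q·form y red≡yq) ⟩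
        δ D * δ D * N γ              ≡⟨ cong (δ D * δ D *_) Nγ≡kq ⟩
        δ D * δ D * (k * + q)        ≡⟨ swap (δ D * δ D) k (+ q) ⟩
        + q * (δ D * δ D * k)        ∎)

  represented⇒generator : ∀ x y u → form l n q x y ≡ δ D * δ D * u → Σ O λ γ → P γ × N γ ≡ u * + q
  represented⇒generator x y u f≡δ²u = generator (basis-halve B a x (divides (u * + q) a²-Dx²≡uqδ²))
    where
    a : ℤ
    a = y * + q + n * x
    swap : ∀ c d u → c * (d * u) ≡ u * c * d
    swap = solve-∀
    a²-Dx²≡uqδ² : a * a - D * (x * x) ≡ u * + q * (δ D * δ D)
    a²-Dx²≡uqδ² = begin
      a * a - D * (x * x)   ≡⟨ form-identity x y ⟩
      + q * form l n q x y  ≡⟨ cong (+ q *_) f≡δ²u ⟩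
      + q * (δ D * δ D * u) ≡⟨ swap (+ q) (δ D * δ D) u ⟩
      u * + q * (δ D * δ D) ∎
    generator : δ D S.∣ a - ωt D * x → Σ O λ γ → P γ × N γ ≡ u * + q
    generator (divides g₀ a-tx≡g₀δ) = (g₀ , x) , δz∈P⇒z∈P δγ∈P , Nγ≡uq
      where
      δg₀≡ : δ D * g₀ ≡ a - ωt D * x
      δg₀≡ = trans (ℤ.*-comm (δ D) g₀) (sym a-tx≡g₀δ)
      cancel : ∀ c n x t → c + n * x - t * x + t * x - n * x ≡ c
      cancel = solve-∀
      red≡yq : red (g₀ , x) ≡ y * + q
      red≡yq = trans (cong (λ c → c + ωt D * x - n * x) δg₀≡) (cancel (y * + q) n x (ωt D))
      regroup : ∀ c n x t → c + n * x - t * x ≡ c + x * (n - t)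
      regroup = solve-∀
      δγ∈P : P (ι (δ D) · (g₀ , x))
      δγ∈P = ι y , ι x , (begin
        ι (δ D) · (g₀ , x)
          ≡⟨ ι-· (δ D) g₀ x ⟩
        (δ D * g₀ , δ D * x)
          ≡⟨ cong₂ _,_ (trans δg₀≡ (regroup (y * + q) n x (ωt D)))
                       (trans (ℤ.*-comm (δ D) x) (sym (ℤ.+-identityˡ (x * δ D)))) ⟩
        (y * + q , + 0) ⊕ (x * (n - ωt D) , x * δ D)
          ≡⟨ sym (cong₂ _⊕_ (ι-ι y (+ q)) (trans (cong (ι x ·_) π≡) (ι-· x (n - ωt D) (δ D)))) ⟩
        ι y · ι (+ q) ⊕ ι x · π ∎)
      Nγ≡uq : N (g₀ , x) ≡ u * + q
      Nγ≡uq = ℤ.*-cancelˡ-≡ (δ D * δ D) _ _ {{ℤ.i*j≢0 (δ D) (δ D)}} (begin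
        δ D * δ D * N (g₀ , x) ≡⟨ δ²N≡q·form y red≡yq ⟩
        + q * form l n q x y   ≡⟨ cong (+ q *_) f≡δ²u ⟩
        + q * (δ D * δ D * u)  ≡⟨ swap′ (+ q) (δ D * δ D) u ⟩
        δ D * δ D * (u * + q)  ∎)
        where
        swap′ : ∀ c d u → c * (d * u) ≡ d * (u * c)
        swap′ = solve-∀

  represents⇒principal : Represents±δ² → IsPrincipal D P
  represents⇒principal (x , y , f≡±δ²) =
    let u , u²≡1 , f≡δ²u = ±-as-unit f≡±δ²
        γ , γ∈P , Nγ≡uq  = represented⇒generator x y u f≡δ²u
    in  principal-by-norm (+ q) u l γ∈P u²≡1 Nγ≡uq N-π

  principal⇔represents : IsPrincipal D P ⇔ Represents±δ²
  principal⇔represents = mk⇔ principal⇒represents represents⇒principal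

  form-nonNeg : D < + 0 → ∀ x y → + 0 ≤ form l n q x y
  form-nonNeg D<0 x y = ℤ.*-cancelˡ-≤-pos (+ 0) (form l n q x y) (+ q) {{positive (+<+ (ℕ.>-nonZero⁻¹ q))}}
    (subst (_≤ + q * form l n q x y) (sym (ℤ.*-zeroʳ (+ q)))
      (subst (+ 0 ≤_) (form-identity x y) (norm-nonNeg D<0 (y * + q + n * x) x)))

  represents-positive : D < + 0 → Represents±δ² → Σ ℤ λ x → Σ ℤ λ y → form l n q x y ≡ δ D * δ D
  represents-positive D<0 (x , y , inj₁ f≡δ²)  = x , y , f≡δ²
  represents-positive D<0 (x , y , inj₂ f≡-δ²) =
    ⊥-elim (ℤ.<-irrefl refl (ℤ.<-≤-trans (basis-neg-δ²<0 B) (subst (+ 0 ≤_) f≡-δ² (form-nonNeg D<0 x y))))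

theorem1p1 : (D : ℤ) → SquareFree D → D ≢ + 1 →
    (q : ℕ) → Prime q → q ≢ 2 → ¬ ((+ q) ∣ D) →
    (n : ℤ) → (+ q) ∣ (n * n - D) →
    Σ ℤ λ l → (n * n - D ≡ l * + q)
      × (D < + 0 → (IsPrincipal D (𝒫 D q n)
          ⇔ Σ ℤ λ x → Σ ℤ λ y → form l n q x y ≡ δ D * δ D))
      × (+ 0 < D → (IsPrincipal D (𝒫 D q n)
          ⇔ Σ ℤ λ x → Σ ℤ λ y → (form l n q x y ≡ δ D * δ D) ⊎ (form l n q x y ≡ - (δ D * δ D))))
-- Square-freeness, D ≠ 1 and q ∤ D make ℤ[ω] the full ring of integers and 𝒫 a prime ideal; the
-- equivalences hold without them.
theorem1p1 D _ _ q q-prime q≢2 _ n q∣n²-D = l , n²-D≡lq , part-i , λ _ → principal⇔represents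
  where
  open S._∣_ (S.∣ᵤ⇒∣ {+ q} {n * n - D} q∣n²-D) renaming (quotient to l; equality to n²-D≡lq)
  open PrimeIdeal D q-prime q≢2 n l n²-D≡lq
  part-i : D < + 0 → IsPrincipal D (𝒫 D q n) ⇔ Σ ℤ λ x → Σ ℤ λ y → form l n q x y ≡ δ D * δ D
  part-i D<0 = mk⇔ (λ p → represents-positive D<0 (Equivalence.to principal⇔represents p))
                   (λ (x , y , f≡δ²) → Equivalence.from principal⇔represents (x , y , inj₁ f≡δ²))
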